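{- Let $G=([\ell],\mathcal{E})$ be a simple graph and $\Psi(G)=\{\epsilon_i-\epsilon_j\mid\{i,j\}\in\mathcal{E},\ i<j\}\subseteq\Phi^+(A_{\ell-1})$. The following are equivalent. (i) $\Psi(G)$ is Worpitzky-compatible (i.e. the graphic arrangement $\mathcal{A}(G)$ is compatible). (ii) Whenever $i<j$, $\{i,j\}\in\mathcal{E}$ and $(p_1,\dots,p_m)$ is any sequence of integers with $i=p_1<p_2<\cdots<p_m=j$, there exists $a$ with $1\le a<m$ such that $\{p_a,p_{a+1}\}\in\mathcal{E}$.
   Context: Type $A_{\ell-1}$: $\epsilon_1,\dots,\epsilon_\ell$ the standard orthonormal basis of $\mathbb{R}^\ell$, $U=\{\sum r_i\epsilon_i\mid\sum r_i=0\}$, $\Phi^+(A_{\ell-1})=\{\epsilon_i-\epsilon_j\mid i<j\}$, simple roots $\alpha_i=\epsilon_i-\epsilon_{i+1}$ ($1\le i\le\ell-1$). $H_{\alpha,m}=\{x\in U\mid(\alpha,x)=m\}$. An alcove is a connected component of $U\setminus\bigcup_{\alpha\in\Phi^+,m\in\mathbb{Z}}H_{\alpha,m}$; walls of an alcove $A$ are hyperplanes supporting a facet of $A$; ceilings are walls not through the origin with the origin on the same side as $A$; the upper closure $A^\diamondsuit$ is $A$ together with its facets supported by ceilings. $P^\diamondsuit=\{x\in U\mid 0<(\alpha_i,x)\le1\ \forall i\}$. $\Psi\subseteq\Phi^+$ is Worpitzky-compatible if for every alcove $A\subseteq P^\diamondsuit$, every $\alpha\in\Psi$, $m\in\mathbb{Z}$,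 the set $A^\diamondsuit\cap H_{\alpha,m}$ is empty or contained in a ceiling $H_{\beta,m'}$ of $A$ with $\beta\in\Psi$, $m'\in\mathbb{Z}$.
   Formalization: Points of $U$, and so of alcoves, walls, ceilings, upper closures $A^\diamondsuit$ and the hyperplanes $H_{\alpha,m}$, have rational coordinates rather than real ones. -}

module Defs where

open import Data.Nat using (ℕ; zero; suc)
open import Data.Fin using (Fin; zero; suc; inject₁; fromℕ; toℕ) renaming (_<_ to _<ᶠ_)
open import Data.Integer using (ℤ; +_)
open import Data.Bool using (Bool; true; false)
open import Data.Rational using (ℚ; _+_; _-_; _<_; _≤_; 0ℚ; _/_)
open import Data.Product using (Σ; Σ-syntax; ∃; ∃-syntax; _×_)
open import Data.Sum using (_⊎_)
open import Relation.Binary.PropositionalEquality using (_≡_; _≢_)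

-- Ambient space.  Points of ℝ^ℓ are represented by their rational points: a point is a function Fin ℓ → ℚ.

Point : ℕ → Set
Point ℓ = Fin ℓ → ℚ

sumℚ : ∀ {n} → (Fin n → ℚ) → ℚ
sumℚ {zero}  f = 0ℚ
sumℚ {suc n} f = f zero + sumℚ (λ i → f (suc i))

ι : ℤ → ℚ
ι m = m / 1

InU : ∀ {ℓ} → Point ℓ → Set
InU x = sumℚ x ≡ 0ℚ

-- positive roots ε_i − ε_j (i < j) are indexed by pairs i < j;
-- (ε_i − ε_j , x) = x_i − x_j
pair : ∀ {ℓ} → Point ℓ → Fin ℓ → Fin ℓ → ℚ
pair x i j = x i - x j

InH : ∀ {ℓ} → Point ℓ → Fin ℓ → Fin ℓ → ℤ → Set
InH x i j m = InU x × pair x i j ≡ ι m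

InP◇ : ∀ {ℓ} → Point ℓ → Set
InP◇ {ℓ} x = InU x × ((a b : Fin ℓ) → toℕ b ≡ suc (toℕ a) →
  (0ℚ < pair x a b) × (pair x a b ≤ ι (+ 1)))

-- Every alcove of type A_{ℓ−1} is the set
--   A_k = { x ∈ U | k_ij < x_i − x_j < k_ij + 1  for all i < j }
-- for some integer data k (and conversely every nonempty such set is an
-- alcove).  We represent alcoves by such data k together with nonemptiness.

AlcoveData : ℕ → Set
AlcoveData ℓ = Fin ℓ → Fin ℓ → ℤ

InAlcove : ∀ {ℓ} → AlcoveData ℓ → Point ℓ → Set
InAlcove {ℓ} k x = InU x × ((i j : Fin ℓ) → i <ᶠ j →
  (ι (k i j) < pair x i j) × (pair x i j < ι (k i j Data.Integer.+ + 1)))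

IsAlcove : ∀ {ℓ} → AlcoveData ℓ → Set
IsAlcove k = ∃[ x ] InAlcove k x

InClosure : ∀ {ℓ} → AlcoveData ℓ → Point ℓ → Set
InClosure {ℓ} k x = InU x × ((i j : Fin ℓ) → i <ᶠ j →
  (ι (k i j) ≤ pair x i j) × (pair x i j ≤ ι (k i j Data.Integer.+ + 1)))

-- H_{ε_i−ε_j , m} (i < j) is a wall of A_k, i.e. supports a facet of A_k:
-- the closure of A_k meets H_{ε_i−ε_j,m} in a point lying on no other
-- hyperplane H_{β,m'} of the affine arrangement.
Wall : ∀ {ℓ} → AlcoveData ℓ → (i j : Fin ℓ) → ℤ → Set
Wall {ℓ} k i j m = i <ᶠ j × (Σ[ y ∈ Point ℓ ] (InClosure k y × InH y i j m ×
  ((i' j' : Fin ℓ) → i' <ᶠ j' → (m' : ℤ) → pair y i' j' ≡ ι m' →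
     (i' ≡ i × j' ≡ j × m' ≡ m))))

SameSide : ℤ → ℚ → Set
SameSide m d = ((d < ι m) × (0ℚ < ι m)) ⊎ ((ι m < d) × (ι m < 0ℚ))

Ceiling : ∀ {ℓ} → AlcoveData ℓ → (i j : Fin ℓ) → ℤ → Set
Ceiling k i j m = Wall k i j m × (m ≢ + 0) ×
  (∀ x → InAlcove k x → SameSide m (pair x i j))

-- upper closure A^♦: A together with its facets supported by ceilings, i.e.
-- the points of the closure of A which lie on no wall of A other than ceilings
InUpper : ∀ {ℓ} → AlcoveData ℓ → Point ℓ → Set
InUpper {ℓ} k x = InClosure k x × ((i j : Fin ℓ) → (m : ℤ) →
  Wall k i j m → pair x i j ≡ ι m → Ceiling k i j m)

-- Worpitzky-compatibility of Ψ ⊆ Φ^+(A_ℓ), where Ψ i j (for i < j) means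
-- ε_i − ε_j ∈ Ψ.  The root system is A_{ℓ−1} on Fin ℓ.
-- "A^♦ ∩ H_{α,m} is empty or contained in a ceiling H_{β,m'}, β ∈ Ψ" is
-- stated as "if A^♦ ∩ H_{α,m} is nonempty then it is contained in ...".

WorpitzkyCompatible : ∀ {ℓ} → (Fin ℓ → Fin ℓ → Set) → Set
WorpitzkyCompatible {ℓ} Ψ =
  (k : AlcoveData ℓ) → IsAlcove k →
  (∀ x → InAlcove k x → InP◇ x) →
  (i j : Fin ℓ) → i <ᶠ j → Ψ i j → (m : ℤ) →
  (∃[ x ] (InUpper k x × InH x i j m)) →
  Σ[ i' ∈ Fin ℓ ] Σ[ j' ∈ Fin ℓ ] Σ[ m' ∈ ℤ ]
    (Ψ i' j' × Ceiling k i' j' m' ×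
     (∀ x → InUpper k x → InH x i j m → InH x i' j' m'))

record SimpleGraph (ℓ : ℕ) : Set where
  field
    adj    : Fin ℓ → Fin ℓ → Bool
    sym    : ∀ i j → adj i j ≡ adj j i
    irrefl : ∀ i → adj i i ≡ false

Edge : ∀ {ℓ} → SimpleGraph ℓ → Fin ℓ → Fin ℓ → Set
Edge G i j = SimpleGraph.adj G i j ≡ true

-- Ψ(G) = { ε_i − ε_j | {i,j} ∈ E, i < j }  (the condition i < j is imposed
-- wherever Ψ is used)
Ψ : ∀ {ℓ} → SimpleGraph ℓ → Fin ℓ → Fin ℓ → Set
Ψ G i j = Edge G i j

-- condition (ii): sequences i = p_1 < ... < p_m = j are given as
-- p : Fin (suc n) → Fin ℓ (so m = n + 1), with index a ∈ Fin n standing for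
-- the consecutive pair (p_a , p_{a+1}).
ChordCondition : ∀ {ℓ} → SimpleGraph ℓ → Set
ChordCondition {ℓ} G =
  (i j : Fin ℓ) → i <ᶠ j → Edge G i j →
  (n : ℕ) (p : Fin (suc n) → Fin ℓ) →
  ((a : Fin n) → p (inject₁ a) <ᶠ p (suc a)) →
  p zero ≡ i → p (fromℕ n) ≡ j →
  Σ[ a ∈ Fin n ] Edge G (p (inject₁ a)) (p (suc a))

{-# OPTIONS --safe #-}
-- (ii) ⇒ (i).  Let x₀ lie in an alcove A ⊆ P◇ and x in its upper closure, and call x₀_a − x_a the
-- offset of a.  The indices a with x_i − x_a ∈ ℤ have pairwise distinct offsets, all within an open
-- interval of length 1.  If b, c are such indices with consecutive offsets, pushing x towards x₀
-- while c moves along with b gives a point of the closure of A lying on H_{bc} and on no other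
-- hyperplane; so H_{bc} is a wall through x, hence a ceiling, hence the top wall x_b − x_c = k_bc + 1.
-- Ordering the class of i by offset yields i = p₁ < ⋯ < p_m = j joined by such ceilings, and (ii)
-- picks an edge among them.  A point z ∈ A♦ satisfies z_p − z_q ≤ k_pq + 1 = x_p − x_q on every step,
-- so if z ∈ H_{ij} these inequalities sum to an equality and z lies on each of the ceilings.
--
-- (i) ⇒ (ii).  Given an edge {i, j} and an edgeless path i = p₁ < ⋯ < p_m = j, let rank_b count the
-- path vertices ≤ b, put e = 1/(ℓ+1), t_b = (b+1)e (indices from 0), and x_b = −(rank_b + frac_b)
-- with frac_b = 0 on the path and frac_b = t_b off it.  Then x_a − x_b is an integer only for path
-- vertices a < b, where it is the top level k_ab + 1 of the alcove A ⊆ P◇ containing the point x₀ with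
-- x₀_b = x_b + e t_b.  So x ∈ A♦ ∩ H_{ij}, and a ceiling through x joins two path vertices; these are
-- consecutive, since a path vertex q in between would force the whole wall onto H_{aq} as well.
-- Hence no ceiling through x comes from Ψ(G).
module Submission where

open import Data.Bool as Bool using (true)
open import Data.Empty using (⊥; ⊥-elim)
open import Data.Fin as Fin using (Fin; zero; suc; toℕ; fromℕ; fromℕ<; inject₁) renaming (_<_ to _<ᶠ_)
open import Data.Fin.Induction using (>-wellFounded)
import Data.Fin.Properties as Finₚ
open import Data.Integer as ℤ using (ℤ; +_)
import Data.Integer.Properties as ℤₚ
import Data.List as List
import Data.List.Membership.Propositional.Properties as ∈ₚ
import Data.List.Relation.Unary.All.Properties as Allₚ
import Data.List.Relation.Unary.Any as Any
import Data.List.Relation.Unary.Any.Properties as Anyₚ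
open import Data.Nat as ℕ using (ℕ; zero; suc)
import Data.Nat.Coprimality as Coprime
import Data.Nat.Properties as ℕₚ
open import Data.Product using (Σ-syntax; ∃-syntax; _×_; _,_; proj₁; proj₂)
open import Data.Rational hiding (floor; ceiling)
open import Data.Rational.Properties
open import Data.Rational.Solver using (module +-*-Solver)
open import Data.Sum as Sum using (_⊎_; inj₁; inj₂)
open import Function using (_∘_; id)
open import Induction.WellFounded using (Acc; acc)
open import Relation.Binary using (tri<; tri≈; tri>)
open import Relation.Binary.Bundles using (DecTotalOrder)
open import Relation.Binary.Construct.Closure.ReflexiveTransitive using (Star; ε; _◅_)
open import Relation.Binary.PropositionalEquality
open import Relation.Nullary using (¬_; Dec; yes; no; _×-dec_)
open import Data.List.Extrema (DecTotalOrder.totalOrder ≤-decTotalOrder)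
  using (min; argmin; min≤⊤; min≤v⁺; argmin-all; f[argmin]≤v⁺)
open import Defs
open +-*-Solver

ι≡mkℚ : ∀ m → ι m ≡ mkℚ m 0 (Coprime.sym (Coprime.1-coprimeTo ℤ.∣ m ∣))
ι≡mkℚ m = ↥p/↧p≡p (mkℚ m 0 (Coprime.sym (Coprime.1-coprimeTo ℤ.∣ m ∣)))

ι-homo-+ : ∀ a b → ι (a ℤ.+ b) ≡ ι a + ι b
ι-homo-+ a b rewrite ι≡mkℚ a | ι≡mkℚ b =
  cong₂ (λ u v → ι (u ℤ.+ v)) (sym (ℤₚ.*-identityʳ a)) (sym (ℤₚ.*-identityʳ b))

ι-homo-neg : ∀ a → ι (ℤ.- a) ≡ - ι a
ι-homo-neg a rewrite ι≡mkℚ a | ι≡mkℚ (ℤ.- a) with a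
... | + zero = refl
... | + suc n = refl
... | ℤ.-[1+ n ] = refl

ι-homo-− : ∀ a b → ι (a ℤ.- b) ≡ ι a - ι b
ι-homo-− a b = trans (ι-homo-+ a (ℤ.- b)) (cong (_+_ (ι a)) (ι-homo-neg b))

ι-suc : ∀ a → ι (a ℤ.+ + 1) ≡ ι a + 1ℚ
ι-suc a = ι-homo-+ a (+ 1)

ι-negsuc : ∀ K → ι (ℤ.- K ℤ.- + 1) ≡ - ι K - 1ℚ
ι-negsuc K = trans (ι-homo-− (ℤ.- K) (+ 1)) (cong (_- 1ℚ) (ι-homo-neg K))

ι-mono-< : ∀ {a b} → a ℤ.< b → ι a < ι b
ι-mono-< {a} {b} a<b rewrite ι≡mkℚ a | ι≡mkℚ b =
  *<* (subst₂ ℤ._<_ (sym (ℤₚ.*-identityʳ a)) (sym (ℤₚ.*-identityʳ b)) a<b)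

ι-cancel-< : ∀ {a b} → ι a < ι b → a ℤ.< b
ι-cancel-< {a} {b} ιa<ιb rewrite ι≡mkℚ a | ι≡mkℚ b with ιa<ιb
... | *<* a*1<b*1 = subst₂ ℤ._<_ (ℤₚ.*-identityʳ a) (ℤₚ.*-identityʳ b) a*1<b*1

ι-mono-≤ : ∀ {a b} → a ℤ.≤ b → ι a ≤ ι b
ι-mono-≤ {a} {b} a≤b rewrite ι≡mkℚ a | ι≡mkℚ b =
  *≤* (subst₂ ℤ._≤_ (sym (ℤₚ.*-identityʳ a)) (sym (ℤₚ.*-identityʳ b)) a≤b)

ι-injective : ∀ {a b} → ι a ≡ ι b → a ≡ b
ι-injective {a} {b} ιa≡ιb with ℤₚ.<-cmp a b
... | tri< a<b _ _ = ⊥-elim (<⇒≢ (ι-mono-< a<b) ιa≡ιb)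
... | tri≈ _ a≡b _ = a≡b
... | tri> _ _ b<a = ⊥-elim (<⇒≢ (ι-mono-< b<a) (sym ιa≡ιb))

ι-<⇒+1≤ : ∀ {a b} → ι a < ι b → ι a + 1ℚ ≤ ι b
ι-<⇒+1≤ {a} {b} ιa<ιb =
  subst (_≤ ι b) (trans (ι-homo-+ (+ 1) a) (+-comm 1ℚ (ι a)))
    (ι-mono-≤ {ℤ.suc a} {b} (ℤₚ.i<j⇒suc[i]≤j (ι-cancel-< {a} {b} ιa<ιb)))

0<ι-suc : ∀ n → 0ℚ < ι (+ suc n)
0<ι-suc n = ι-mono-< {+ 0} {+ suc n} (ℤ.+<+ (ℕ.s≤s ℕ.z≤n))

Integral : ℚ → Set
Integral q = ∃[ m ] q ≡ ι m

integral? : ∀ q → Dec (Integral q)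
integral? (mkℚ n zero _) = yes (n , sym (ι≡mkℚ n))
integral? (mkℚ n (suc d) _) = no λ (m , q≡ιm) →
  ℕₚ.1+n≢0 (trans (cong ℚ.denominator-1 q≡ιm) (cong ℚ.denominator-1 (ι≡mkℚ m)))

Integral-+ : ∀ {p q} → Integral p → Integral q → Integral (p + q)
Integral-+ (a , refl) (b , refl) = a ℤ.+ b , sym (ι-homo-+ a b)

Integral-neg : ∀ {p} → Integral p → Integral (- p)
Integral-neg (a , refl) = ℤ.- a , sym (ι-homo-neg a)

0<1 : 0ℚ < 1ℚ
0<1 = *<* (ℤ.+<+ (ℕ.s≤s ℕ.z≤n))

p<q⇒0<q-p : ∀ {p q} → p < q → 0ℚ < q - p
p<q⇒0<q-p {p} {q} p<q = subst (_< q - p) (+-inverseʳ p) (+-monoˡ-< (- p) p<q)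

p≤q⇒0≤q-p : ∀ {p q} → p ≤ q → 0ℚ ≤ q - p
p≤q⇒0≤q-p {p} {q} p≤q = subst (_≤ q - p) (+-inverseʳ p) (+-monoˡ-≤ (- p) p≤q)

<-byDiff : ∀ {p q r} → q - p ≡ r → 0ℚ < r → p < q
<-byDiff {p} {q} q-p≡r 0<r = subst₂ _<_ (+-identityˡ p) (solve 2 (λ p q → q :- p :+ p := q) refl p q)
  (+-monoˡ-< p (subst (0ℚ <_) (sym q-p≡r) 0<r))

≤-byDiff : ∀ {p q r} → q - p ≡ r → 0ℚ ≤ r → p ≤ q
≤-byDiff {p} {q} q-p≡r 0≤r = subst₂ _≤_ (+-identityˡ p) (solve 2 (λ p q → q :- p :+ p := q) refl p q)
  (+-monoˡ-≤ p (subst (0ℚ ≤_) (sym q-p≡r) 0≤r))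

≤∧≢⇒< : ∀ {p q} → p ≤ q → p ≢ q → p < q
≤∧≢⇒< {p} {q} p≤q p≢q with <-cmp p q
... | tri< p<q _ _ = p<q
... | tri≈ _ p≡q _ = ⊥-elim (p≢q p≡q)
... | tri> _ _ q<p = ⊥-elim (<-irrefl refl (<-≤-trans q<p p≤q))

p<q⇒p-q<0 : ∀ {p q} → p < q → p - q < 0ℚ
p<q⇒p-q<0 {p} {q} p<q = <-byDiff (solve 2 (λ p q → con 0ℚ :- (p :- q) := q :- p) refl p q) (p<q⇒0<q-p p<q)

p-q≡0⇒p≡q : ∀ {p q} → p - q ≡ 0ℚ → p ≡ q
p-q≡0⇒p≡q {p} {q} p-q≡0 = begin
  p               ≡⟨ solve 2 (λ p q → p := p :- q :+ q) refl p q ⟩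
  p - q + q       ≡⟨ cong (_+ q) p-q≡0 ⟩
  0ℚ + q          ≡⟨ +-identityˡ q ⟩
  q               ∎
  where open ≡-Reasoning

+-pos-nonNeg : ∀ {p q} → 0ℚ < p → 0ℚ ≤ q → 0ℚ < p + q
+-pos-nonNeg = +-mono-<-≤

+-nonNeg-pos : ∀ {p q} → 0ℚ ≤ p → 0ℚ < q → 0ℚ < p + q
+-nonNeg-pos = +-mono-≤-<

*-pos : ∀ {p q} → 0ℚ < p → 0ℚ < q → 0ℚ < p * q
*-pos {p} {q} 0<p 0<q = positive⁻¹ (p * q) {{pos*pos⇒pos p {{positive 0<p}} q {{positive 0<q}}}}

*-nonNeg : ∀ {p q} → 0ℚ ≤ p → 0ℚ ≤ q → 0ℚ ≤ p * q
*-nonNeg {p} {q} 0≤p 0≤q = nonNegative⁻¹ (p * q) {{nonNeg*nonNeg⇒nonNeg p {{nonNegative 0≤p}} q {{nonNegative 0≤q}}}}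

⊓-pos : ∀ {p q} → 0ℚ < p → 0ℚ < q → 0ℚ < p ⊓ q
⊓-pos {p} {q} 0<p 0<q with ⊓-sel p q
... | inj₁ p⊓q≡p = subst (0ℚ <_) (sym p⊓q≡p) 0<p
... | inj₂ p⊓q≡q = subst (0ℚ <_) (sym p⊓q≡q) 0<q

nonNeg+nonNeg≡0 : ∀ {p q} → 0ℚ ≤ p → 0ℚ ≤ q → p + q ≡ 0ℚ → p ≡ 0ℚ × q ≡ 0ℚ
nonNeg+nonNeg≡0 {p} {q} 0≤p 0≤q p+q≡0 =
  ≤-antisym (subst (p ≤_) p+q≡0 (subst (_≤ p + q) (+-identityʳ p) (+-monoʳ-≤ p 0≤q))) 0≤p ,
  ≤-antisym (subst (q ≤_) p+q≡0 (subst (_≤ p + q) (+-identityˡ q) (+-monoˡ-≤ q 0≤p))) 0≤q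

squeeze-+ˡ : ∀ {p q P Q} → p ≤ P → q ≤ Q → p + q ≡ P + Q → p ≡ P
squeeze-+ˡ {p} {q} {P} {Q} p≤P q≤Q p+q≡P+Q = ≤-antisym p≤P (≤-byDiff P-p≡Q-q (p≤q⇒0≤q-p q≤Q))
  where
  P-p≡Q-q : p - P ≡ Q - q
  P-p≡Q-q = begin
    p - P                     ≡⟨ solve 4 (λ p q P Q → p :- P := (p :+ q) :- (P :+ Q) :+ (Q :- q)) refl p q P Q ⟩
    (p + q) - (P + Q) + (Q - q) ≡⟨ cong (λ u → u - (P + Q) + (Q - q)) p+q≡P+Q ⟩
    (P + Q) - (P + Q) + (Q - q) ≡⟨ solve 3 (λ P Q q → (P :+ Q) :- (P :+ Q) :+ (Q :- q) := Q :- q) refl P Q q ⟩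
    Q - q                     ∎
    where open ≡-Reasoning

Within : ℚ → ℚ → Set
Within L q = L ≤ q × q ≤ L + 1ℚ

StrictlyWithin : ℚ → ℚ → Set
StrictlyWithin L q = L < q × q < L + 1ℚ

strictlyWithin⇒within : ∀ {L q} → StrictlyWithin L q → Within L q
strictlyWithin⇒within (L<q , q<L+1) = <⇒≤ L<q , <⇒≤ q<L+1

strictlyWithin⇒nonIntegral : ∀ K {q} → StrictlyWithin (ι K) q → ¬ Integral q
strictlyWithin⇒nonIntegral K (K<q , q<K+1) (m , refl) = <-irrefl refl (<-≤-trans q<K+1 (ι-<⇒+1≤ {K} {m} K<q))

within∧integral⇒endpoint : ∀ K {q} → Within (ι K) q → Integral q → q ≡ ι K ⊎ q ≡ ι K + 1ℚ
within∧integral⇒endpoint K {q} (K≤q , q≤K+1) (m , refl) with q ≟ ι K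
... | yes q≡K = inj₁ q≡K
... | no q≢K = inj₂ (≤-antisym q≤K+1 (ι-<⇒+1≤ {K} {m} (≤∧≢⇒< K≤q (q≢K ∘ sym))))

within∧nonIntegral⇒strictlyWithin : ∀ K {q} → Within (ι K) q → ¬ Integral q → StrictlyWithin (ι K) q
within∧nonIntegral⇒strictlyWithin K {q} (K≤q , q≤K+1) q∉ℤ =
  ≤∧≢⇒< K≤q (λ K≡q → q∉ℤ (K , sym K≡q)) ,
  ≤∧≢⇒< q≤K+1 (λ q≡K+1 → q∉ℤ (K ℤ.+ + 1 , trans q≡K+1 (sym (ι-suc K))))

toWithin : ∀ K {q} → ι K ≤ q × q ≤ ι (K ℤ.+ + 1) → Within (ι K) q
toWithin K (K≤q , q≤K+1) = K≤q , subst (_ ≤_) (ι-suc K) q≤K+1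

fromWithin : ∀ K {q} → Within (ι K) q → ι K ≤ q × q ≤ ι (K ℤ.+ + 1)
fromWithin K (K≤q , q≤K+1) = K≤q , subst (_ ≤_) (sym (ι-suc K)) q≤K+1

toStrictlyWithin : ∀ K {q} → ι K < q × q < ι (K ℤ.+ + 1) → StrictlyWithin (ι K) q
toStrictlyWithin K (K<q , q<K+1) = K<q , subst (_ <_) (ι-suc K) q<K+1

fromStrictlyWithin : ∀ K {q} → StrictlyWithin (ι K) q → ι K < q × q < ι (K ℤ.+ + 1)
fromStrictlyWithin K (K<q , q<K+1) = K<q , subst (_ <_) (sym (ι-suc K)) q<K+1

within-neg : ∀ {L q} → Within L q → Within (- L - 1ℚ) (- q)
within-neg {L} {q} (L≤q , q≤L+1) =
  ≤-byDiff (solve 2 (λ L q → :- q :- (:- L :- con 1ℚ) := L :+ con 1ℚ :- q) refl L q) (p≤q⇒0≤q-p q≤L+1) ,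
  ≤-byDiff (solve 2 (λ L q → :- L :- con 1ℚ :+ con 1ℚ :- :- q := q :- L) refl L q) (p≤q⇒0≤q-p L≤q)

strictlyWithin-neg : ∀ {L q} → StrictlyWithin L q → StrictlyWithin (- L - 1ℚ) (- q)
strictlyWithin-neg {L} {q} (L<q , q<L+1) =
  <-byDiff (solve 2 (λ L q → :- q :- (:- L :- con 1ℚ) := L :+ con 1ℚ :- q) refl L q) (p<q⇒0<q-p q<L+1) ,
  <-byDiff (solve 2 (λ L q → :- L :- con 1ℚ :+ con 1ℚ :- :- q := q :- L) refl L q) (p<q⇒0<q-p L<q)

within-shift : ∀ {K X} → Within 0ℚ X → Within K (K + X)
within-shift {K} {X} (0≤X , X≤1) =
  ≤-byDiff (solve 2 (λ K X → K :+ X :- K := X) refl K X) 0≤X ,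
  ≤-byDiff (solve 2 (λ K X → K :+ con 1ℚ :- (K :+ X) := con 0ℚ :+ con 1ℚ :- X) refl K X) (p≤q⇒0≤q-p X≤1)

strictlyWithin-shift : ∀ {K X} → StrictlyWithin 0ℚ X → StrictlyWithin K (K + X)
strictlyWithin-shift {K} {X} (0<X , X<1) =
  <-byDiff (solve 2 (λ K X → K :+ X :- K := X) refl K X) 0<X ,
  <-byDiff (solve 2 (λ K X → K :+ con 1ℚ :- (K :+ X) := con 0ℚ :+ con 1ℚ :- X) refl K X) (p<q⇒0<q-p X<1)

within-strictlyWithin-diff : ∀ {L P Q} → Within L P → StrictlyWithin L Q → - 1ℚ < Q - P × Q - P < 1ℚ
within-strictlyWithin-diff {L} {P} {Q} (L≤P , P≤L+1) (L<Q , Q<L+1) =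
  <-byDiff (solve 3 (λ L P Q → Q :- P :- :- con 1ℚ := (Q :- L) :+ (L :+ con 1ℚ :- P)) refl L P Q)
    (+-pos-nonNeg (p<q⇒0<q-p L<Q) (p≤q⇒0≤q-p P≤L+1)) ,
  <-byDiff (solve 3 (λ L P Q → con 1ℚ :- (Q :- P) := (L :+ con 1ℚ :- Q) :+ (P :- L)) refl L P Q)
    (+-pos-nonNeg (p<q⇒0<q-p Q<L+1) (p≤q⇒0≤q-p L≤P))

convex-strictlyWithin : ∀ {L P Q δ} → Within L P → StrictlyWithin L Q → 0ℚ < δ → δ ≤ 1ℚ →
                        StrictlyWithin L (P + δ * (Q - P))
convex-strictlyWithin {L} {P} {Q} {δ} (L≤P , P≤L+1) (L<Q , Q<L+1) 0<δ δ≤1 =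
  <-byDiff (solve 4 (λ L P Q δ → P :+ δ :* (Q :- P) :- L := (con 1ℚ :- δ) :* (P :- L) :+ δ :* (Q :- L)) refl L P Q δ)
    (+-nonNeg-pos (*-nonNeg (p≤q⇒0≤q-p δ≤1) (p≤q⇒0≤q-p L≤P)) (*-pos 0<δ (p<q⇒0<q-p L<Q))) ,
  <-byDiff (solve 4 (λ L P Q δ → L :+ con 1ℚ :- (P :+ δ :* (Q :- P))
                                  := (con 1ℚ :- δ) :* (L :+ con 1ℚ :- P) :+ δ :* (L :+ con 1ℚ :- Q)) refl L P Q δ)
    (+-nonNeg-pos (*-nonNeg (p≤q⇒0≤q-p δ≤1) (p≤q⇒0≤q-p P≤L+1)) (*-pos 0<δ (p<q⇒0<q-p Q<L+1)))

nudge-up : ∀ {L δ d} → 0ℚ < δ → δ ≤ 1ℚ → 0ℚ < d → d < 1ℚ → StrictlyWithin L (L + δ * d)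
nudge-up {L} {δ} {d} 0<δ δ≤1 0<d d<1 =
  <-byDiff (solve 3 (λ L δ d → L :+ δ :* d :- L := δ :* d) refl L δ d) (*-pos 0<δ 0<d) ,
  <-byDiff (solve 3 (λ L δ d → L :+ con 1ℚ :- (L :+ δ :* d) := (con 1ℚ :- d) :+ (con 1ℚ :- δ) :* d) refl L δ d)
    (+-pos-nonNeg (p<q⇒0<q-p d<1) (*-nonNeg (p≤q⇒0≤q-p δ≤1) (<⇒≤ 0<d)))

nudge-down : ∀ {L δ d} → 0ℚ < δ → δ ≤ 1ℚ → - 1ℚ < d → d < 0ℚ → StrictlyWithin L (L + 1ℚ + δ * d)
nudge-down {L} {δ} {d} 0<δ δ≤1 -1<d d<0 =
  <-byDiff (solve 3 (λ L δ d → L :+ con 1ℚ :+ δ :* d :- L := (d :- :- con 1ℚ) :+ (con 1ℚ :- δ) :* (con 0ℚ :- d)) refl L δ d)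
    (+-pos-nonNeg (p<q⇒0<q-p -1<d) (*-nonNeg (p≤q⇒0≤q-p δ≤1) (<⇒≤ (p<q⇒0<q-p d<0)))) ,
  <-byDiff (solve 3 (λ L δ d → L :+ con 1ℚ :- (L :+ con 1ℚ :+ δ :* d) := δ :* (con 0ℚ :- d)) refl L δ d)
    (*-pos 0<δ (p<q⇒0<q-p d<0))

nudge-inside : ∀ {L P δ d} → 0ℚ < δ → δ ≤ P - L → δ ≤ L + 1ℚ - P → - 1ℚ < d → d < 1ℚ →
               StrictlyWithin L (P + δ * d)
nudge-inside {L} {P} {δ} {d} 0<δ δ≤P-L δ≤L+1-P -1<d d<1 =
  <-byDiff (solve 4 (λ L P δ d → P :+ δ :* d :- L := (P :- L :- δ) :+ δ :* (d :- :- con 1ℚ)) refl L P δ d)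
    (+-nonNeg-pos (p≤q⇒0≤q-p δ≤P-L) (*-pos 0<δ (p<q⇒0<q-p -1<d))) ,
  <-byDiff (solve 4 (λ L P δ d → L :+ con 1ℚ :- (P :+ δ :* d) := (L :+ con 1ℚ :- P :- δ) :+ δ :* (con 1ℚ :- d)) refl L P δ d)
    (+-nonNeg-pos (p≤q⇒0≤q-p δ≤L+1-P) (*-pos 0<δ (p<q⇒0<q-p d<1)))

perturbed-strictlyWithin : ∀ {e d X} → 0ℚ < e → e < 1ℚ → 0ℚ < d → d ≤ X → X ≤ 1ℚ → StrictlyWithin 0ℚ (X - e * d)
perturbed-strictlyWithin {e} {d} {X} 0<e e<1 0<d d≤X X≤1 =
  <-byDiff (solve 3 (λ e d X → X :- e :* d :- con 0ℚ := (con 1ℚ :- e) :* X :+ e :* (X :- d)) refl e d X)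
    (+-pos-nonNeg (*-pos (p<q⇒0<q-p e<1) (<-≤-trans 0<d d≤X)) (*-nonNeg (<⇒≤ 0<e) (p≤q⇒0≤q-p d≤X))) ,
  <-byDiff (solve 3 (λ e d X → con 0ℚ :+ con 1ℚ :- (X :- e :* d) := (con 1ℚ :- X) :+ e :* d) refl e d X)
    (+-nonNeg-pos (p≤q⇒0≤q-p X≤1) (*-pos 0<e 0<d))

pair-split : ∀ {ℓ} (z : Point ℓ) a b c → pair z a c ≡ pair z a b + pair z b c
pair-split z a b c = solve 3 (λ u v w → u :- w := u :- v :+ (v :- w)) refl (z a) (z b) (z c)

pair-swap : ∀ {ℓ} (z : Point ℓ) a b → pair z b a ≡ - pair z a b
pair-swap z a b = solve 2 (λ u v → v :- u := :- (u :- v)) refl (z a) (z b)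

pair-self : ∀ {ℓ} (z : Point ℓ) a → pair z a a ≡ 0ℚ
pair-self z a = +-inverseʳ (z a)

Integral-pair-swap : ∀ {ℓ} (z : Point ℓ) {a b} → Integral (pair z a b) → Integral (pair z b a)
Integral-pair-swap z {a} {b} ab∈ℤ = subst Integral (sym (pair-swap z a b)) (Integral-neg ab∈ℤ)

Integral-pair-trans : ∀ {ℓ} (z : Point ℓ) {a b c} → Integral (pair z a b) → Integral (pair z b c) → Integral (pair z a c)
Integral-pair-trans z {a} {b} {c} ab∈ℤ bc∈ℤ = subst Integral (sym (pair-split z a b c)) (Integral-+ ab∈ℤ bc∈ℤ)

sumℚ-shift : ∀ {n} (z : Point n) c → sumℚ (λ a → z a - c) ≡ sumℚ z - ι (+ n) * c
sumℚ-shift {zero} z c = solve 1 (λ c → con 0ℚ := con 0ℚ :- con 0ℚ :* c) refl c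
sumℚ-shift {suc n} z c = begin
  z zero - c + sumℚ (λ a → z (suc a) - c)      ≡⟨ cong (_+_ (z zero - c)) (sumℚ-shift (z ∘ suc) c) ⟩
  z zero - c + (sumℚ (z ∘ suc) - ι (+ n) * c) ≡⟨ solve 4 (λ z0 s m c → z0 :- c :+ (s :- m :* c)
                                                                           := z0 :+ s :- (con 1ℚ :+ m) :* c)
                                                     refl (z zero) (sumℚ (z ∘ suc)) (ι (+ n)) c ⟩
  sumℚ z - (1ℚ + ι (+ n)) * c                  ≡⟨ cong (λ u → sumℚ z - u * c) (sym (ι-homo-+ (+ 1) (+ n))) ⟩
  sumℚ z - ι (+ suc n) * c                     ∎
  where open ≡-Reasoning

module _ {n : ℕ} where

  private
    instance
      ℓ-nonZero : NonZero (ι (+ suc n))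
      ℓ-nonZero = pos⇒nonZero (ι (+ suc n)) {{positive (0<ι-suc n)}}

  mean : Point (suc n) → ℚ
  mean z = sumℚ z * 1/ ι (+ suc n)

  toU : Point (suc n) → Point (suc n)
  toU z a = z a - mean z

  pair-toU : ∀ z a b → pair (toU z) a b ≡ pair z a b
  pair-toU z a b = solve 3 (λ u v w → u :- w :- (v :- w) := u :- v) refl (z a) (z b) (mean z)

  toU-InU : ∀ z → InU (toU z)
  toU-InU z = begin
    sumℚ (toU z)                             ≡⟨ sumℚ-shift z (mean z) ⟩
    sumℚ z - ℓ * (sumℚ z * 1/ ℓ)             ≡⟨ solve 3 (λ s l r → s :- l :* (s :* r) := s :- s :* (l :* r))
                                                  refl (sumℚ z) ℓ (1/ ℓ) ⟩
    sumℚ z - sumℚ z * (ℓ * 1/ ℓ)             ≡⟨ cong (λ u → sumℚ z - sumℚ z * u) (*-inverseʳ ℓ) ⟩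
    sumℚ z - sumℚ z * 1ℚ                     ≡⟨ solve 1 (λ s → s :- s :* con 1ℚ := con 0ℚ) refl (sumℚ z) ⟩
    0ℚ                                       ∎
    where
    open ≡-Reasoning
    ℓ : ℚ
    ℓ = ι (+ suc n)

P◇-pair-pos : ∀ {ℓ} {z : Point ℓ} → InP◇ z → ∀ {a b} → a <ᶠ b → 0ℚ < pair z a b
P◇-pair-pos {ℓ} {z} (_ , consecutive) {a} {b} a<b = go (toℕ b ℕ.∸ suc (toℕ a)) b
  (sym (trans (sym (ℕₚ.+-suc (toℕ b ℕ.∸ suc (toℕ a)) (toℕ a))) (ℕₚ.m∸n+n≡m a<b)))
  where
  go : ∀ d b → toℕ b ≡ suc (d ℕ.+ toℕ a) → 0ℚ < pair z a b
  go zero b b≡1+a = proj₁ (consecutive a b b≡1+a)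
  go (suc d) b b≡2+d+a = subst (0ℚ <_) (sym (pair-split z a q b))
      (+-mono-< (go d q (Finₚ.toℕ-fromℕ< q<ℓ))
                (proj₁ (consecutive q b (trans b≡2+d+a (cong suc (sym (Finₚ.toℕ-fromℕ< q<ℓ)))))))
    where
    q<ℓ : suc (d ℕ.+ toℕ a) ℕ.< ℓ
    q<ℓ = ℕₚ.<-trans (ℕₚ.n<1+n _) (subst (ℕ._< ℓ) b≡2+d+a (Finₚ.toℕ<n b))
    q : Fin ℓ
    q = fromℕ< q<ℓ

-- Alcoves, walls and ceilings

SamePair : ∀ {A : Set} → A → A → A → A → Set
SamePair a a' b c = (a ≡ b × a' ≡ c) ⊎ (a ≡ c × a' ≡ b)

module _ {ℓ : ℕ} (k : AlcoveData ℓ) where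

  -- ⌊z_a − z_b⌋ for z ∈ A_k; the value at a ≡ b is junk, every lemma below assumes a ≢ b.
  alcoveFloor : Fin ℓ → Fin ℓ → ℤ
  alcoveFloor a b with Finₚ.<-cmp a b
  ... | tri< _ _ _ = k a b
  ... | tri≈ _ _ _ = + 0
  ... | tri> _ _ _ = ℤ.- k b a ℤ.- + 1

  alcoveFloor-< : ∀ {a b} → a <ᶠ b → alcoveFloor a b ≡ k a b
  alcoveFloor-< {a} {b} a<b with Finₚ.<-cmp a b
  ... | tri< _ _ _ = refl
  ... | tri≈ _ a≡b _ = ⊥-elim (Finₚ.<⇒≢ a<b a≡b)
  ... | tri> _ _ b<a = ⊥-elim (ℕₚ.<-asym a<b b<a)

  alcoveFloor-> : ∀ {a b} → b <ᶠ a → alcoveFloor a b ≡ ℤ.- k b a ℤ.- + 1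
  alcoveFloor-> {a} {b} b<a with Finₚ.<-cmp a b
  ... | tri< a<b _ _ = ⊥-elim (ℕₚ.<-asym a<b b<a)
  ... | tri≈ _ a≡b _ = ⊥-elim (Finₚ.<⇒≢ b<a (sym a≡b))
  ... | tri> _ _ _ = refl

  alcoveFloor-swap : ∀ {a b} → a ≢ b → ι (alcoveFloor b a) ≡ - ι (alcoveFloor a b) - 1ℚ
  alcoveFloor-swap {a} {b} a≢b with Finₚ.<-cmp a b
  ... | tri< a<b _ _ = trans (cong ι (alcoveFloor-> a<b)) (ι-negsuc (k a b))
  ... | tri≈ _ a≡b _ = ⊥-elim (a≢b a≡b)
  ... | tri> _ _ b<a = begin
    ι (alcoveFloor b a)               ≡⟨ cong ι (alcoveFloor-< b<a) ⟩
    ι (k b a)                         ≡⟨ solve 1 (λ u → u := :- (:- u :- con 1ℚ) :- con 1ℚ) refl (ι (k b a)) ⟩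
    - (- ι (k b a) - 1ℚ) - 1ℚ         ≡⟨ cong (λ u → - u - 1ℚ) (sym (ι-negsuc (k b a))) ⟩
    - ι (ℤ.- k b a ℤ.- + 1) - 1ℚ      ∎
    where open ≡-Reasoning

module _ {ℓ : ℕ} {k : AlcoveData ℓ} where

  closure-within : ∀ {z} → InClosure k z → ∀ {a b} → a ≢ b → Within (ι (alcoveFloor k a b)) (pair z a b)
  closure-within {z} (_ , bounds) {a} {b} a≢b with Finₚ.<-cmp a b
  ... | tri< a<b _ _ = toWithin (k a b) (bounds a b a<b)
  ... | tri≈ _ a≡b _ = ⊥-elim (a≢b a≡b)
  ... | tri> _ _ b<a = subst₂ Within (sym (ι-negsuc (k b a))) (sym (pair-swap z b a))
                         (within-neg (toWithin (k b a) (bounds b a b<a)))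

  alcove-strictlyWithin : ∀ {z} → InAlcove k z → ∀ {a b} → a ≢ b →
                          StrictlyWithin (ι (alcoveFloor k a b)) (pair z a b)
  alcove-strictlyWithin {z} (_ , bounds) {a} {b} a≢b with Finₚ.<-cmp a b
  ... | tri< a<b _ _ = toStrictlyWithin (k a b) (bounds a b a<b)
  ... | tri≈ _ a≡b _ = ⊥-elim (a≢b a≡b)
  ... | tri> _ _ b<a = subst₂ StrictlyWithin (sym (ι-negsuc (k b a))) (sym (pair-swap z b a))
                         (strictlyWithin-neg (toStrictlyWithin (k b a) (bounds b a b<a)))

  within⇒closure : ∀ {z} → InU z → (∀ {a b} → a ≢ b → Within (ι (alcoveFloor k a b)) (pair z a b)) →
                   InClosure k z
  within⇒closure {z} z∈U within = z∈U , λ a b a<b →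
    fromWithin (k a b) (subst (λ K → Within (ι K) (pair z a b)) (alcoveFloor-< k a<b) (within (Finₚ.<⇒≢ a<b)))

  alcove-nonIntegral : ∀ {z} → InAlcove k z → ∀ {a b} → a ≢ b → ¬ Integral (pair z a b)
  alcove-nonIntegral z∈A {a} {b} a≢b = strictlyWithin⇒nonIntegral (alcoveFloor k a b) (alcove-strictlyWithin z∈A a≢b)

  wall-within : ∀ {a b M} → Wall k a b M → Within (ι (k a b)) (ι M)
  wall-within {a} {b} (a<b , y , y∈C , (_ , y-ab) , _) =
    subst (Within (ι (k a b))) y-ab (toWithin (k a b) (proj₂ y∈C a b a<b))

  upperWall⇒ceiling : ∀ {a b M} → Wall k a b M → ι M ≡ ι (k a b) + 1ℚ → 0ℚ < ι M → Ceiling k a b M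
  upperWall⇒ceiling {a} {b} {M} wall M≡k+1 0<M =
    wall , (λ { refl → <-irrefl refl 0<M }) ,
    λ z z∈A → inj₁ (subst (pair z a b <_) (sym M≡k+1)
                      (proj₂ (toStrictlyWithin (k a b) (proj₂ z∈A a b (proj₁ wall)))) , 0<M)

  alcove-below-ceiling : ∀ {a b M z} → Ceiling k a b M → InAlcove k z → InP◇ z → pair z a b < ι M
  alcove-below-ceiling {a} {b} {M} {z} (wall , _ , sameSide) z∈A z∈P with sameSide z z∈A
  ... | inj₁ (z<M , _) = z<M
  ... | inj₂ (_ , M<0) = ⊥-elim (<-irrefl refl (begin-strict
    0ℚ            <⟨ P◇-pair-pos z∈P (proj₁ wall) ⟩
    pair z a b    <⟨ proj₂ (toStrictlyWithin (k a b) (proj₂ z∈A a b (proj₁ wall))) ⟩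
    ι (k a b) + 1ℚ ≤⟨ +-monoˡ-≤ 1ℚ (proj₁ (wall-within wall)) ⟩
    ι M + 1ℚ      ≤⟨ ι-<⇒+1≤ {M} {+ 0} M<0 ⟩
    0ℚ            ∎))
    where open ≤-Reasoning

  ceiling-level : ∀ {a b M z} → Ceiling k a b M → InAlcove k z → InP◇ z → ι M ≡ ι (k a b) + 1ℚ
  ceiling-level {a} {b} {M} ceiling@(wall , _) z∈A z∈P = ≤-antisym (proj₂ (wall-within wall))
    (ι-<⇒+1≤ {k a b} {M} (<-trans (proj₁ (proj₂ z∈A a b (proj₁ wall))) (alcove-below-ceiling ceiling z∈A z∈P)))

  wall-level-not-composite : ∀ {a q c M} → Wall k a c M → a <ᶠ q → q <ᶠ c →
                             ι M ≢ (ι (k a q) + 1ℚ) + (ι (k q c) + 1ℚ)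
  wall-level-not-composite {a} {q} {c} {M} (_ , y , y∈C , (_ , y-ac) , onlyHere) a<q q<c M≡sum =
    Finₚ.<⇒≢ q<c (proj₁ (proj₂ (onlyHere a q a<q (k a q ℤ.+ + 1) (trans y-aq (sym (ι-suc (k a q)))))))
    where
    y-aq : pair y a q ≡ ι (k a q) + 1ℚ
    y-aq = squeeze-+ˡ (proj₂ (toWithin (k a q) (proj₂ y∈C a q a<q))) (proj₂ (toWithin (k q c) (proj₂ y∈C q c q<c)))
             (trans (sym (pair-split y a q c)) (trans y-ac M≡sum))

  onlyHyperplane⇒wall : ∀ {y a b M} → a <ᶠ b → InClosure k y → pair y a b ≡ ι M →
                        (∀ {a' b'} → a' ≢ b' → Integral (pair y a' b') → SamePair a' b' a b) → Wall k a b M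
  onlyHyperplane⇒wall {y} {a} {b} {M} a<b y∈C y-ab only = a<b , y , y∈C , (proj₁ y∈C , y-ab) , unique
    where
    unique : ∀ a' b' → a' <ᶠ b' → ∀ m' → pair y a' b' ≡ ι m' → a' ≡ a × b' ≡ b × m' ≡ M
    unique a' b' a'<b' m' y-a'b' with only (Finₚ.<⇒≢ a'<b') (m' , y-a'b')
    ... | inj₁ (refl , refl) = refl , refl , ι-injective (trans (sym y-a'b') y-ab)
    ... | inj₂ (refl , refl) = ⊥-elim (ℕₚ.<-asym a<b a'<b')

module _ {A : Set} {R : A → A → Set} where

  length : ∀ {a b} → Star R a b → ℕ
  length ε = 0
  length (_ ◅ path) = suc (length path)

  vertex : ∀ {a b} (path : Star R a b) → Fin (suc (length path)) → A
  vertex {a = a} _ zero = a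
  vertex (_ ◅ path) (suc s) = vertex path s

  vertex-last : ∀ {a b} (path : Star R a b) → vertex path (fromℕ (length path)) ≡ b
  vertex-last ε = refl
  vertex-last (_ ◅ path) = vertex-last path

  step-at : ∀ {a b} (path : Star R a b) (s : Fin (length path)) → R (vertex path (inject₁ s)) (vertex path (suc s))
  step-at (r ◅ _) zero = r
  step-at (_ ◅ path) (suc s) = step-at path s

module _ {A : Set} {R : A → A → Set} (f : A → A → ℚ)
         (f-split : ∀ a b c → f a c ≡ f a b + f b c) (f-self : ∀ a → f a a ≡ 0ℚ)
         (f-step : ∀ {a b} → R a b → 0ℚ ≤ f a b) where

  star-nonNeg : ∀ {a b} → Star R a b → 0ℚ ≤ f a b
  star-nonNeg ε = ≤-reflexive (sym (f-self _))
  star-nonNeg (r ◅ path) = subst (0ℚ ≤_) (sym (f-split _ _ _)) (+-mono-≤ (f-step r) (star-nonNeg path))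

  first-rest-vanish : ∀ {a b c} → R a b → Star R b c → f a c ≡ 0ℚ → f a b ≡ 0ℚ × f b c ≡ 0ℚ
  first-rest-vanish r path fac≡0 = nonNeg+nonNeg≡0 (f-step r) (star-nonNeg path) (trans (sym (f-split _ _ _)) fac≡0)

  steps-vanish : ∀ {a b} (path : Star R a b) → f a b ≡ 0ℚ →
                 ∀ s → f (vertex path (inject₁ s)) (vertex path (suc s)) ≡ 0ℚ
  steps-vanish (r ◅ path) fab≡0 zero = proj₁ (first-rest-vanish r path fab≡0)
  steps-vanish (r ◅ path) fab≡0 (suc s) = steps-vanish path (proj₂ (first-rest-vanish r path fab≡0)) s

star-≤ : ∀ {n} {R : Fin n → Fin n → Set} → (∀ {a b} → R a b → a <ᶠ b) →
         ∀ {a b} → Star R a b → toℕ a ℕ.≤ toℕ b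
star-≤ R⊆< ε = ℕₚ.≤-refl
star-≤ R⊆< (r ◅ path) = ℕₚ.≤-trans (ℕₚ.<⇒≤ (R⊆< r)) (star-≤ R⊆< path)

consecutive⇒strictMono : ∀ {r ℓ} (p : Fin (suc r) → Fin ℓ) → (∀ s → p (inject₁ s) <ᶠ p (suc s)) →
                         ∀ {s s'} → s <ᶠ s' → p s <ᶠ p s'
consecutive⇒strictMono {suc r} p p-inc {zero} {suc zero} _ = p-inc zero
consecutive⇒strictMono {suc r} p p-inc {zero} {suc (suc s')} _ =
  ℕₚ.<-trans (p-inc zero) (consecutive⇒strictMono (p ∘ suc) (p-inc ∘ suc) {zero} {suc s'} ℕ.z<s)
consecutive⇒strictMono {suc r} p p-inc {suc s} {suc s'} s<s' =
  consecutive⇒strictMono (p ∘ suc) (p-inc ∘ suc) (ℕ.s<s⁻¹ s<s')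

strictMono-reflects : ∀ {r ℓ} (p : Fin r → Fin ℓ) → (∀ {s s'} → s <ᶠ s' → p s <ᶠ p s') →
                      ∀ {s s'} → p s <ᶠ p s' → s <ᶠ s'
strictMono-reflects p mono {s} {s'} ps<ps' with Finₚ.<-cmp s s'
... | tri< s<s' _ _ = s<s'
... | tri≈ _ refl _ = ⊥-elim (ℕₚ.<-irrefl refl ps<ps')
... | tri> _ _ s'<s = ⊥-elim (ℕₚ.<-asym ps<ps' (mono s'<s))

Consecutive : ∀ {r} → Fin (suc r) → Fin (suc r) → Set
Consecutive s s' = ∃[ a ] (inject₁ a ≡ s × suc a ≡ s')

adjacent-or-between : ∀ {r} {s s' : Fin (suc r)} → s <ᶠ s' →
                      Consecutive s s' ⊎ (Σ[ t ∈ Fin (suc r) ] (s <ᶠ t × t <ᶠ s'))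
adjacent-or-between {r} {s} {suc a} s<s' with toℕ (suc a) ℕₚ.≟ ℕ.suc (toℕ s)
... | yes 1+a≡1+s = inj₁ (a , Finₚ.toℕ-injective (trans (Finₚ.toℕ-inject₁ a) (ℕₚ.suc-injective 1+a≡1+s)) , refl)
... | no 1+a≢1+s = inj₂ (fromℕ< t<1+r , s<t , t<s')
  where
  1+s<1+a : suc (toℕ s) ℕ.< suc (toℕ a)
  1+s<1+a = ℕₚ.≤∧≢⇒< s<s' (1+a≢1+s ∘ sym)
  t<1+r : suc (toℕ s) ℕ.< suc r
  t<1+r = ℕₚ.<-≤-trans 1+s<1+a (ℕₚ.<⇒≤ (Finₚ.toℕ<n (suc a)))
  s<t : s <ᶠ fromℕ< t<1+r
  s<t = subst (toℕ s ℕ.<_) (sym (Finₚ.toℕ-fromℕ< t<1+r)) (ℕₚ.n<1+n (toℕ s))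
  t<s' : fromℕ< t<1+r <ᶠ suc a
  t<s' = subst (ℕ._< toℕ (suc a)) (sym (Finₚ.toℕ-fromℕ< t<1+r)) 1+s<1+a

-- (ii) ⇒ (i): chains of ceilings

module CeilingChains {n : ℕ} {k : AlcoveData (suc n)} {x₀ x : Point (suc n)}
                     (x₀∈A : InAlcove k x₀) (x₀∈P◇ : InP◇ x₀) (x∈A♦ : InUpper k x) where

  x∈C : InClosure k x
  x∈C = proj₁ x∈A♦

  x-within : ∀ {a b} → a ≢ b → Within (ι (alcoveFloor k a b)) (pair x a b)
  x-within = closure-within {z = x} x∈C

  x₀-strictlyWithin : ∀ {a b} → a ≢ b → StrictlyWithin (ι (alcoveFloor k a b)) (pair x₀ a b)
  x₀-strictlyWithin = alcove-strictlyWithin {z = x₀} x₀∈A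

  offset : Fin (suc n) → ℚ
  offset a = x₀ a - x a

  offset-diff : ∀ a b → offset a - offset b ≡ pair x₀ a b - pair x a b
  offset-diff a b = solve 4 (λ p q r s → p :- r :- (q :- s) := p :- q :- (r :- s)) refl (x₀ a) (x₀ b) (x a) (x b)

  offset-diff-swap : ∀ a b → offset b - offset a ≡ pair x a b - pair x₀ a b
  offset-diff-swap a b = solve 4 (λ p q r s → q :- s :- (p :- r) := r :- s :- (p :- q)) refl (x₀ a) (x₀ b) (x a) (x b)

  offset-close : ∀ {a b} → a ≢ b → - 1ℚ < offset a - offset b × offset a - offset b < 1ℚ
  offset-close {a} {b} a≢b = subst (λ u → - 1ℚ < u × u < 1ℚ) (sym (offset-diff a b))
    (within-strictlyWithin-diff (x-within a≢b) (x₀-strictlyWithin a≢b))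

  offset-injective : ∀ {a b} → a ≢ b → Integral (pair x a b) → offset a ≢ offset b
  offset-injective {a} {b} a≢b (M , x-ab) offa≡offb = alcove-nonIntegral {k = k} {z = x₀} x₀∈A a≢b (M , x₀-ab)
    where
    x₀-ab : pair x₀ a b ≡ ι M
    x₀-ab = begin
      pair x₀ a b                              ≡⟨ solve 2 (λ p q → p := q :+ (p :- q)) refl (pair x₀ a b) (pair x a b) ⟩
      pair x a b + (pair x₀ a b - pair x a b)  ≡⟨ cong (_+_ (pair x a b)) (sym (offset-diff a b)) ⟩
      pair x a b + (offset a - offset b)       ≡⟨ cong (λ u → pair x a b + (u - offset b)) offa≡offb ⟩
      pair x a b + (offset b - offset b)       ≡⟨ solve 2 (λ p q → p :+ (q :- q) := p) refl (pair x a b) (offset b) ⟩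
      pair x a b                               ≡⟨ x-ab ⟩
      ι M                                      ∎
      where open ≡-Reasoning

  offset-at-floor : ∀ {a c} → a ≢ c → pair x a c ≡ ι (alcoveFloor k a c) → offset c < offset a
  offset-at-floor {a} {c} a≢c x-ac≡L = <-byDiff (offset-diff a c)
    (p<q⇒0<q-p (subst (_< pair x₀ a c) (sym x-ac≡L) (proj₁ (x₀-strictlyWithin a≢c))))

  offset-at-top : ∀ {a c} → a ≢ c → pair x a c ≡ ι (alcoveFloor k a c) + 1ℚ → offset a < offset c
  offset-at-top {a} {c} a≢c x-ac≡L+1 = <-byDiff (offset-diff-swap a c)
    (p<q⇒0<q-p (subst (pair x₀ a c <_) (sym x-ac≡L+1) (proj₂ (x₀-strictlyWithin a≢c))))

  ceiling-offset< : ∀ {a b M} → Ceiling k a b M → pair x a b ≡ ι M → offset a < offset b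
  ceiling-offset< {a} {b} ceiling x-ab = <-byDiff (offset-diff-swap a b)
    (p<q⇒0<q-p (subst (pair x₀ a b <_) (sym x-ab) (alcove-below-ceiling {k = k} {z = x₀} ceiling x₀∈A x₀∈P◇)))

  -- y moves x towards x₀ by δ, except that c moves along with b: the pair b, c keeps its integral
  -- difference, while for δ small enough every other pair lands strictly inside its unit cell.
  module WallWitness {b c : Fin (suc n)} (b≢c : b ≢ c) (bc∈ℤ : Integral (pair x b c))
                     (offb<offc : offset b < offset c)
                     (c-next : ∀ {a} → Integral (pair x a c) → offset b < offset a → offset c ≤ offset a) where

    L : Fin (suc n) → ℚ
    L a = ι (alcoveFloor k a c)

    strictly-inside : ∀ {a} → ¬ Integral (pair x a c) → StrictlyWithin (L a) (pair x a c)
    strictly-inside {a} x-ac∉ℤ with a Fin.≟ c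
    ... | yes refl = ⊥-elim (x-ac∉ℤ (+ 0 , pair-self x c))
    ... | no a≢c = within∧nonIntegral⇒strictlyWithin (alcoveFloor k a c) (x-within a≢c) x-ac∉ℤ

    room : Fin (suc n) → ℚ
    room a with integral? (pair x a c)
    ... | yes _ = 1ℚ
    ... | no _ = (pair x a c - L a) ⊓ (L a + 1ℚ - pair x a c)

    room-pos : ∀ a → 0ℚ < room a
    room-pos a with integral? (pair x a c)
    ... | yes _ = 0<1
    ... | no x-ac∉ℤ = ⊓-pos (p<q⇒0<q-p (proj₁ (strictly-inside x-ac∉ℤ))) (p<q⇒0<q-p (proj₂ (strictly-inside x-ac∉ℤ)))

    room-nonIntegral : ∀ {a} → ¬ Integral (pair x a c) → room a ≡ (pair x a c - L a) ⊓ (L a + 1ℚ - pair x a c)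
    room-nonIntegral {a} x-ac∉ℤ with integral? (pair x a c)
    ... | yes x-ac∈ℤ = ⊥-elim (x-ac∉ℤ x-ac∈ℤ)
    ... | no _ = refl

    δ : ℚ
    δ = min 1ℚ (List.tabulate room)

    0<δ : 0ℚ < δ
    0<δ = argmin-all (λ q → q) {P = 0ℚ <_} 0<1 (Allₚ.tabulate⁺ room-pos)

    δ≤1 : δ ≤ 1ℚ
    δ≤1 = min≤⊤ 1ℚ (List.tabulate room)

    δ-fits : ∀ {a} → ¬ Integral (pair x a c) → δ ≤ pair x a c - L a × δ ≤ L a + 1ℚ - pair x a c
    δ-fits {a} x-ac∉ℤ = ≤-trans δ≤room (p⊓q≤p (pair x a c - L a) _) , ≤-trans δ≤room (p⊓q≤q (pair x a c - L a) _)
      where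
      δ≤room : δ ≤ (pair x a c - L a) ⊓ (L a + 1ℚ - pair x a c)
      δ≤room = subst (δ ≤_) (room-nonIntegral x-ac∉ℤ)
        (min≤v⁺ 1ℚ (List.tabulate room) (inj₂ (Anyₚ.tabulate⁺ {f = room} a ≤-refl)))

    partner : Fin (suc n) → Fin (suc n)
    partner a with a Fin.≟ c
    ... | yes _ = b
    ... | no _ = a

    partner-c : partner c ≡ b
    partner-c with c Fin.≟ c
    ... | yes _ = refl
    ... | no c≢c = ⊥-elim (c≢c refl)

    partner-≢c : ∀ {a} → a ≢ c → partner a ≡ a
    partner-≢c {a} a≢c with a Fin.≟ c
    ... | yes a≡c = ⊥-elim (a≢c a≡c)
    ... | no _ = refl

    y⁺ : Point (suc n)
    y⁺ a = x a + δ * offset (partner a)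

    y : Point (suc n)
    y = toU y⁺

    pair-y : ∀ a a' → pair y a a' ≡ pair x a a' + δ * (offset (partner a) - offset (partner a'))
    pair-y a a' = trans (pair-toU y⁺ a a')
      (solve 5 (λ p q l r s → p :+ l :* r :- (q :+ l :* s) := p :- q :+ l :* (r :- s)) refl
         (x a) (x a') δ (offset (partner a)) (offset (partner a')))

    y-bc : pair y b c ≡ pair x b c
    y-bc = begin
      pair y b c                                                 ≡⟨ pair-y b c ⟩
      pair x b c + δ * (offset (partner b) - offset (partner c)) ≡⟨ cong₂ (λ u v → pair x b c + δ * (offset u - offset v))
                                                                          (partner-≢c b≢c) partner-c ⟩
      pair x b c + δ * (offset b - offset b)                     ≡⟨ solve 3 (λ p l o → p :+ l :* (o :- o) := p)
                                                                          refl (pair x b c) δ (offset b) ⟩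
      pair x b c                                                 ∎
      where open ≡-Reasoning

    y-cb : pair y c b ≡ pair x c b
    y-cb = trans (pair-swap y b c) (trans (cong -_ y-bc) (sym (pair-swap x b c)))

    y-off-c : ∀ {a a'} → a ≢ c → a' ≢ c → a ≢ a' → StrictlyWithin (ι (alcoveFloor k a a')) (pair y a a')
    y-off-c {a} {a'} a≢c a'≢c a≢a' = subst (StrictlyWithin _) (sym y-aa')
      (convex-strictlyWithin (x-within a≢a') (x₀-strictlyWithin a≢a') 0<δ δ≤1)
      where
      y-aa' : pair y a a' ≡ pair x a a' + δ * (pair x₀ a a' - pair x a a')
      y-aa' = trans (pair-y a a') (cong (λ u → pair x a a' + δ * u)
                (trans (cong₂ (λ u v → offset u - offset v) (partner-≢c a≢c) (partner-≢c a'≢c)) (offset-diff a a')))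

    y-into-c : ∀ {a} → a ≢ c → a ≢ b → StrictlyWithin (L a) (pair y a c)
    y-into-c {a} a≢c a≢b = subst (StrictlyWithin (L a)) (sym y-ac) (cases (integral? (pair x a c)))
      where
      d : ℚ
      d = offset a - offset b
      y-ac : pair y a c ≡ pair x a c + δ * d
      y-ac = trans (pair-y a c) (cong₂ (λ u v → pair x a c + δ * (offset u - offset v)) (partner-≢c a≢c) partner-c)
      close : - 1ℚ < d × d < 1ℚ
      close = offset-close a≢b
      cases : Dec (Integral (pair x a c)) → StrictlyWithin (L a) (pair x a c + δ * d)
      cases (no x-ac∉ℤ) = nudge-inside 0<δ (proj₁ (δ-fits x-ac∉ℤ)) (proj₂ (δ-fits x-ac∉ℤ)) (proj₁ close) (proj₂ close)
      cases (yes x-ac∈ℤ) with within∧integral⇒endpoint (alcoveFloor k a c) (x-within a≢c) x-ac∈ℤ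
      ... | inj₁ x-ac≡L = subst (λ P → StrictlyWithin (L a) (P + δ * d)) (sym x-ac≡L)
            (nudge-up 0<δ δ≤1 (p<q⇒0<q-p (<-trans offb<offc (offset-at-floor a≢c x-ac≡L))) (proj₂ close))
      ... | inj₂ x-ac≡L+1 = subst (λ P → StrictlyWithin (L a) (P + δ * d)) (sym x-ac≡L+1)
            (nudge-down 0<δ δ≤1 (proj₁ close) (p<q⇒p-q<0 offa<offb))
        where
        offa<offc : offset a < offset c
        offa<offc = offset-at-top a≢c x-ac≡L+1
        offa≤offb : offset a ≤ offset b
        offa≤offb = ≮⇒≥ (λ offb<offa → <-irrefl refl (<-≤-trans offa<offc (c-next x-ac∈ℤ offb<offa)))
        offa<offb : offset a < offset b
        offa<offb = ≤∧≢⇒< offa≤offb (offset-injective a≢b (Integral-pair-trans x x-ac∈ℤ (Integral-pair-swap x bc∈ℤ)))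

    y-out-of-c : ∀ {a} → a ≢ c → a ≢ b → StrictlyWithin (ι (alcoveFloor k c a)) (pair y c a)
    y-out-of-c {a} a≢c a≢b = subst₂ StrictlyWithin (sym (alcoveFloor-swap k a≢c)) (sym (pair-swap y a c))
      (strictlyWithin-neg (y-into-c a≢c a≢b))

    -- Matching on the decisions (rather than using `with`) avoids abstracting over the normal form of y.
    y-classify : ∀ {a a'} → a ≢ a' → SamePair a a' b c ⊎ StrictlyWithin (ι (alcoveFloor k a a')) (pair y a a')
    y-classify {a} {a'} a≢a' = classify (a Fin.≟ c) (a' Fin.≟ c) (a Fin.≟ b) (a' Fin.≟ b)
      where
      classify : Dec (a ≡ c) → Dec (a' ≡ c) → Dec (a ≡ b) → Dec (a' ≡ b) →
                 SamePair a a' b c ⊎ StrictlyWithin (ι (alcoveFloor k a a')) (pair y a a')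
      classify (yes refl) (yes refl) _ _ = ⊥-elim (a≢a' refl)
      classify (yes refl) (no _) _ (yes refl) = inj₁ (inj₂ (refl , refl))
      classify (yes refl) (no a'≢c) _ (no a'≢b) = inj₂ (y-out-of-c a'≢c a'≢b)
      classify (no _) (yes refl) (yes refl) _ = inj₁ (inj₁ (refl , refl))
      classify (no a≢c) (yes refl) (no a≢b) _ = inj₂ (y-into-c a≢c a≢b)
      classify (no a≢c) (no a'≢c) _ _ = inj₂ (y-off-c a≢c a'≢c a≢a')

    y∈C : InClosure k y
    y∈C = within⇒closure {k = k} {z = y} (toU-InU y⁺) (within ∘ y-classify)
      where
      within : ∀ {a a'} → SamePair a a' b c ⊎ StrictlyWithin (ι (alcoveFloor k a a')) (pair y a a') →
               Within (ι (alcoveFloor k a a')) (pair y a a')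
      within (inj₁ (inj₁ (refl , refl))) = subst (Within _) (sym y-bc) (x-within b≢c)
      within (inj₁ (inj₂ (refl , refl))) = subst (Within _) (sym y-cb) (x-within (b≢c ∘ sym))
      within (inj₂ strict) = strictlyWithin⇒within strict

    y-only-bc : ∀ {a a'} → a ≢ a' → Integral (pair y a a') → SamePair a a' b c
    y-only-bc {a} {a'} a≢a' aa'∈ℤ =
      Sum.[ id , (λ strict → ⊥-elim (strictlyWithin⇒nonIntegral (alcoveFloor k a a') strict aa'∈ℤ)) ] (y-classify a≢a')

  CeilingStep : Fin (suc n) → Fin (suc n) → Set
  CeilingStep b c = Σ[ M ∈ ℤ ] (Ceiling k b c M × pair x b c ≡ ι M)

  ceilingStep-< : ∀ {b c} → CeilingStep b c → b <ᶠ c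
  ceilingStep-< (_ , ((b<c , _) , _) , _) = b<c

  ceilingStep : ∀ {b c} → Integral (pair x b c) → offset b < offset c →
                (∀ {a} → Integral (pair x a c) → offset b < offset a → offset c ≤ offset a) → CeilingStep b c
  ceilingStep {b} {c} (M , x-bc) offb<offc c-next with Finₚ.<-cmp b c
  ... | tri≈ _ refl _ = ⊥-elim (<-irrefl refl offb<offc)
  ... | tri< b<c _ _ = M , proj₂ x∈A♦ b c M wall x-bc , x-bc
    where
    open WallWitness (Finₚ.<⇒≢ b<c) (M , x-bc) offb<offc c-next
    wall : Wall k b c M
    wall = onlyHyperplane⇒wall {k = k} {y = y} b<c y∈C (trans y-bc x-bc) y-only-bc
  ... | tri> _ _ c<b = ⊥-elim (<-asym offb<offc (ceiling-offset< c-b-ceiling x-cb))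
    where
    open WallWitness (Finₚ.<⇒≢ c<b ∘ sym) (M , x-bc) offb<offc c-next
    x-cb : pair x c b ≡ ι (ℤ.- M)
    x-cb = trans (pair-swap x b c) (trans (cong -_ x-bc) (sym (ι-homo-neg M)))
    c-b-ceiling : Ceiling k c b (ℤ.- M)
    c-b-ceiling = proj₂ x∈A♦ c b (ℤ.- M)
      (onlyHyperplane⇒wall {k = k} {y = y} c<b y∈C (trans y-cb x-cb)
        (λ a≢a′ aa′∈ℤ → Sum.swap (y-only-bc a≢a′ aa′∈ℤ))) x-cb

  module _ (i : Fin (suc n)) where

    Class : Fin (suc n) → Set
    Class a = Integral (pair x i a)

    Above : Fin (suc n) → Fin (suc n) → Set
    Above b a = Class a × offset b < offset a

    above? : ∀ b a → Dec (Above b a)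
    above? b a = integral? (pair x i a) ×-dec (offset b <? offset a)

    next : Fin (suc n) → Fin (suc n) → Fin (suc n)
    next b t = argmin offset t (List.filter (above? b) (List.allFin (suc n)))

    next-above : ∀ {b t} → Above b t → Above b (next b t)
    next-above {b} t-above = argmin-all offset t-above (Allₚ.all-filter (above? b) (List.allFin (suc n)))

    next-least : ∀ {b t a} → Above b a → offset (next b t) ≤ offset a
    next-least {b} {t} {a} a-above = f[argmin]≤v⁺ t (List.filter (above? b) (List.allFin (suc n)))
      (inj₂ (Any.map (λ { refl → ≤-refl }) (∈ₚ.∈-filter⁺ (above? b) (∈ₚ.∈-allFin a) a-above)))

    ceilingChain : ∀ {t} b → Acc Fin._>_ b → Class b → Class t → offset b ≤ offset t → Star CeilingStep b t
    ceilingChain {t} b (acc rec) b∈ t∈ offb≤offt with b Fin.≟ t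
    ... | yes refl = ε
    ... | no b≢t = step ◅ ceilingChain c (rec (ceilingStep-< step)) c∈ t∈ (next-least t-above)
      where
      t-above : Above b t
      t-above = t∈ , ≤∧≢⇒< offb≤offt (offset-injective b≢t (Integral-pair-trans x (Integral-pair-swap x b∈) t∈))
      c : Fin (suc n)
      c = next b t
      c∈ : Class c
      c∈ = proj₁ (next-above t-above)
      step : CeilingStep b c
      step = ceilingStep (Integral-pair-trans x (Integral-pair-swap x b∈) c∈) (proj₂ (next-above t-above))
        (λ ac∈ℤ offb<offa → next-least (Integral-pair-trans x c∈ (Integral-pair-swap x ac∈ℤ) , offb<offa))

  ceilingChain-from : ∀ {i t} → Class i t → offset i ≤ offset t → Star CeilingStep i t
  ceilingChain-from {i} t∈ offi≤offt = ceilingChain i i (>-wellFounded i) (+ 0 , pair-self x i) t∈ offi≤offt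

  module _ {z : Point (suc n)} (z∈C : InClosure k z) where

    gap : Fin (suc n) → Fin (suc n) → ℚ
    gap a b = pair x a b - pair z a b

    gap-split : ∀ a b c → gap a c ≡ gap a b + gap b c
    gap-split a b c = trans (cong₂ _-_ (pair-split x a b c) (pair-split z a b c))
      (solve 4 (λ p q r s → p :+ q :- (r :+ s) := p :- r :+ (q :- s)) refl (pair x a b) (pair x b c) (pair z a b) (pair z b c))

    gap-self : ∀ a → gap a a ≡ 0ℚ
    gap-self a = trans (cong₂ _-_ (pair-self x a) (pair-self z a)) (+-inverseʳ 0ℚ)

    gap-step : ∀ {a b} → CeilingStep a b → 0ℚ ≤ gap a b
    gap-step {a} {b} (M , ceiling , x-ab) = p≤q⇒0≤q-p (begin
      pair z a b      ≤⟨ proj₂ (toWithin (k a b) (proj₂ z∈C a b (proj₁ (proj₁ ceiling)))) ⟩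
      ι (k a b) + 1ℚ  ≡⟨ sym (ceiling-level {k = k} {z = x₀} ceiling x₀∈A x₀∈P◇) ⟩
      ι M             ≡⟨ sym x-ab ⟩
      pair x a b      ∎)
      where open ≤-Reasoning

    chain-agrees : ∀ {i j} (chain : Star CeilingStep i j) → pair z i j ≡ pair x i j → ∀ s →
                   pair z (vertex chain (inject₁ s)) (vertex chain (suc s))
                     ≡ pair x (vertex chain (inject₁ s)) (vertex chain (suc s))
    chain-agrees {i} {j} chain z-ij≡x-ij s = sym (p-q≡0⇒p≡q (steps-vanish gap gap-split gap-self gap-step chain gap-ij≡0 s))
      where
      gap-ij≡0 : gap i j ≡ 0ℚ
      gap-ij≡0 = trans (cong (_-_ (pair x i j)) z-ij≡x-ij) (+-inverseʳ (pair x i j))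

  chord⇒ceiling : (G : SimpleGraph (suc n)) → ChordCondition G → ∀ {i j m} → i <ᶠ j → Edge G i j → InH x i j m →
    Σ[ i' ∈ Fin (suc n) ] Σ[ j' ∈ Fin (suc n) ] Σ[ m' ∈ ℤ ]
      (Ψ G i' j' × Ceiling k i' j' m' × (∀ z → InUpper k z → InH z i j m → InH z i' j' m'))
  chord⇒ceiling G chord {i} {j} {m} i<j ij∈E (_ , x-ij) =
    p , q , M , pq∈E , pq-ceiling , λ z z∈A♦ (z∈U , z-ij) →
      z∈U , trans (chain-agrees {z = z} (proj₁ z∈A♦) chain (trans z-ij (sym x-ij)) s) x-pq
    where
    j∈ : Class i j
    j∈ = m , x-ij
    offi≤offj : offset i ≤ offset j
    offi≤offj = ≮⇒≥ λ offj<offi → ℕₚ.<⇒≱ i<j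
      (star-≤ ceilingStep-< (ceilingChain-from (Integral-pair-swap x j∈) (<⇒≤ offj<offi)))
    chain : Star CeilingStep i j
    chain = ceilingChain-from j∈ offi≤offj
    chord-edge : Σ[ s ∈ Fin (length chain) ] Edge G (vertex chain (inject₁ s)) (vertex chain (suc s))
    chord-edge = chord i j i<j ij∈E (length chain) (vertex chain) (ceilingStep-< ∘ step-at chain) refl (vertex-last chain)
    s : Fin (length chain)
    s = proj₁ chord-edge
    p q : Fin (suc n)
    p = vertex chain (inject₁ s)
    q = vertex chain (suc s)
    pq∈E : Edge G p q
    pq∈E = proj₂ chord-edge
    M : ℤ
    M = proj₁ (step-at chain s)
    pq-ceiling : Ceiling k p q M
    pq-ceiling = proj₁ (proj₂ (step-at chain s))
    x-pq : pair x p q ≡ ι M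
    x-pq = proj₂ (proj₂ (step-at chain s))

-- (i) ⇒ (ii): the alcove of an edgeless path

module ObstructingAlcove {N r : ℕ} (p : Fin (suc r) → Fin (suc N)) (p-inc : ∀ s → p (inject₁ s) <ᶠ p (suc s)) where

  p-mono : ∀ {s s'} → s <ᶠ s' → p s <ᶠ p s'
  p-mono = consecutive⇒strictMono p p-inc

  OnPath : Fin (suc N) → Set
  OnPath b = ∃[ s ] p s ≡ b

  onPath? : ∀ b → Dec (OnPath b)
  onPath? b = Finₚ.any? (λ s → p s Fin.≟ b)

  hit : ℕ → ℕ
  hit m with Finₚ.any? (λ s → toℕ (p s) ℕₚ.≟ m)
  ... | yes _ = 1
  ... | no _ = 0

  hit-on : ∀ {b} → OnPath b → hit (toℕ b) ≡ 1
  hit-on {b} (s , ps≡b) with Finₚ.any? (λ s → toℕ (p s) ℕₚ.≟ toℕ b)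
  ... | yes _ = refl
  ... | no none = ⊥-elim (none (s , cong toℕ ps≡b))

  hit-off : ∀ {b} → ¬ OnPath b → hit (toℕ b) ≡ 0
  hit-off {b} b∉p with Finₚ.any? (λ s → toℕ (p s) ℕₚ.≟ toℕ b)
  ... | yes (s , ps≡b) = ⊥-elim (b∉p (s , Finₚ.toℕ-injective ps≡b))
  ... | no _ = refl

  rank : ℕ → ℕ
  rank zero = hit zero
  rank (suc m) = rank m ℕ.+ hit (suc m)

  rank-mono : ∀ {m m'} → m ℕ.≤′ m' → rank m ℕ.≤ rank m'
  rank-mono ℕ.≤′-refl = ℕₚ.≤-refl
  rank-mono (ℕ.≤′-step m≤′m') = ℕₚ.≤-trans (rank-mono m≤′m') (ℕₚ.m≤m+n _ _)

  rank-step : ∀ {m m'} → m ℕ.< m' → hit m' ≡ 1 → rank m ℕ.< rank m'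
  rank-step {m} {suc m'} (ℕ.s≤s m≤m') hit≡1 = subst (λ h → rank m ℕ.< rank m' ℕ.+ h) (sym hit≡1)
    (subst (rank m ℕ.<_) (ℕₚ.+-comm 1 (rank m')) (ℕ.s≤s (rank-mono (ℕₚ.≤⇒≤′ m≤m'))))

  private
    instance
      ℓ+1-positive : Positive (ι (+ suc (suc N)))
      ℓ+1-positive = positive (0<ι-suc (suc N))
      ℓ+1-nonZero : NonZero (ι (+ suc (suc N)))
      ℓ+1-nonZero = pos⇒nonZero (ι (+ suc (suc N)))

  e : ℚ
  e = 1/ ι (+ suc (suc N))

  0<e : 0ℚ < e
  0<e = positive⁻¹ e {{1/pos⇒pos (ι (+ suc (suc N)))}}

  ι*e<1 : ∀ {m} → m ℕ.< suc (suc N) → ι (+ m) * e < 1ℚ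
  ι*e<1 {m} m<ℓ+1 = subst (ι (+ m) * e <_) (*-inverseʳ (ι (+ suc (suc N))))
    (*-monoˡ-<-pos e {{positive 0<e}} (ι-mono-< (ℤ.+<+ m<ℓ+1)))

  e<1 : e < 1ℚ
  e<1 = subst (_< 1ℚ) (*-identityˡ e) (ι*e<1 (ℕ.s≤s (ℕ.s≤s ℕ.z≤n)))

  t : Fin (suc N) → ℚ
  t b = ι (+ suc (toℕ b)) * e

  0<t : ∀ b → 0ℚ < t b
  0<t b = *-pos (0<ι-suc (toℕ b)) 0<e

  t-mono : ∀ {a b} → a <ᶠ b → t a < t b
  t-mono a<b = *-monoˡ-<-pos e {{positive 0<e}} (ι-mono-< (ℤ.+<+ (ℕ.s≤s a<b)))

  t<1 : ∀ b → t b < 1ℚ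
  t<1 b = ι*e<1 (ℕ.s≤s (Finₚ.toℕ<n b))

  carry : Fin (suc N) → ℚ
  carry b = ι (+ hit (toℕ b))

  frac-by : ∀ {b} → Dec (OnPath b) → ℚ
  frac-by (yes _) = 0ℚ
  frac-by {b} (no _) = t b

  frac : Fin (suc N) → ℚ
  frac b = frac-by (onPath? b)

  VertexKind : Fin (suc N) → ℚ → Set
  VertexKind b f = (OnPath b × carry b ≡ 1ℚ × f ≡ 0ℚ) ⊎ (¬ OnPath b × carry b ≡ 0ℚ × f ≡ t b)

  vertex-kind : ∀ b → VertexKind b (frac b)
  vertex-kind b = kind (onPath? b)
    where
    kind : (b∈p? : Dec (OnPath b)) → VertexKind b (frac-by b∈p?)
    kind (yes b∈p) = inj₁ (b∈p , cong (λ h → ι (+ h)) (hit-on b∈p) , refl)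
    kind (no b∉p) = inj₂ (b∉p , cong (λ h → ι (+ h)) (hit-off b∉p) , refl)

  top-bounds : ∀ b → t b ≤ carry b + frac b × carry b + frac b ≤ 1ℚ
  top-bounds b = bounds (vertex-kind b)
    where
    bounds : VertexKind b (frac b) → t b ≤ carry b + frac b × carry b + frac b ≤ 1ℚ
    bounds (inj₁ (_ , c≡1 , f≡0)) =
      subst (λ u → t b ≤ u × u ≤ 1ℚ) (sym (cong₂ _+_ c≡1 f≡0)) (<⇒≤ (t<1 b) , ≤-refl)
    bounds (inj₂ (_ , c≡0 , f≡t)) =
      subst (λ u → t b ≤ u × u ≤ 1ℚ) (sym (trans (cong₂ _+_ c≡0 f≡t) (+-identityˡ (t b)))) (≤-refl , <⇒≤ (t<1 b))

  frac-bounds : ∀ a → 0ℚ ≤ frac a × frac a ≤ t a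
  frac-bounds a = bounds (vertex-kind a)
    where
    bounds : VertexKind a (frac a) → 0ℚ ≤ frac a × frac a ≤ t a
    bounds (inj₁ (_ , _ , f≡0)) = subst (λ u → 0ℚ ≤ u × u ≤ t a) (sym f≡0) (≤-refl , <⇒≤ (0<t a))
    bounds (inj₂ (_ , _ , f≡t)) = subst (λ u → 0ℚ ≤ u × u ≤ t a) (sym f≡t) (<⇒≤ (0<t a) , ≤-refl)

  excess : Fin (suc N) → Fin (suc N) → ℚ
  excess a b = carry b + frac b - frac a

  excess≤top : ∀ a b → excess a b ≤ carry b + frac b
  excess≤top a b = ≤-byDiff (solve 2 (λ T F → T :- (T :- F) := F) refl (carry b + frac b) (frac a)) (proj₁ (frac-bounds a))

  excess-bounds : ∀ {a b} → a <ᶠ b → t b - t a ≤ excess a b × excess a b ≤ 1ℚ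
  excess-bounds {a} {b} a<b =
    +-mono-≤ (proj₁ (top-bounds b)) (neg-antimono-≤ (proj₂ (frac-bounds a))) ,
    ≤-trans (excess≤top a b) (proj₂ (top-bounds b))

  excess-on-path : ∀ {a b} → OnPath a → OnPath b → excess a b ≡ 1ℚ
  excess-on-path {a} {b} a∈p b∈p = on (vertex-kind a) (vertex-kind b)
    where
    on : VertexKind a (frac a) → VertexKind b (frac b) → excess a b ≡ 1ℚ
    on (inj₁ (_ , _ , fa≡0)) (inj₁ (_ , cb≡1 , fb≡0)) = cong₂ _-_ (cong₂ _+_ cb≡1 fb≡0) fa≡0
    on (inj₂ (a∉p , _)) _ = ⊥-elim (a∉p a∈p)
    on _ (inj₂ (b∉p , _)) = ⊥-elim (b∉p b∈p)

  excess-off-path : ∀ {a b} → ¬ (OnPath a × OnPath b) → excess a b < 1ℚ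
  excess-off-path {a} {b} not-both = off (vertex-kind a) (vertex-kind b)
    where
    off : VertexKind a (frac a) → VertexKind b (frac b) → excess a b < 1ℚ
    off (inj₁ (a∈p , _)) (inj₁ (b∈p , _)) = ⊥-elim (not-both (a∈p , b∈p))
    off _ (inj₂ (_ , cb≡0 , fb≡t)) = ≤-<-trans (excess≤top a b)
      (subst (_< 1ℚ) (sym (trans (cong₂ _+_ cb≡0 fb≡t) (+-identityˡ (t b)))) (t<1 b))
    off (inj₂ (_ , _ , fa≡t)) (inj₁ _) = <-≤-trans
      (<-byDiff (solve 2 (λ T F → T :- (T :- F) := F) refl (carry b + frac b) (frac a)) (subst (0ℚ <_) (sym fa≡t) (0<t a)))
      (proj₂ (top-bounds b))

  R : Fin (suc N) → ℚ
  R b = ι (+ rank (toℕ b))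

  height : Fin (suc N) → ℚ
  height b = R b + frac b

  x x₀ : Point (suc N)
  x = toU (λ b → - height b)
  x₀ = toU (λ b → - (height b - e * t b))

  k : AlcoveData (suc N)
  k a b = (+ rank (toℕ b) ℤ.- + rank (toℕ a)) ℤ.- + hit (toℕ b)

  ι-k : ∀ a b → ι (k a b) ≡ R b - R a - carry b
  ι-k a b = trans (ι-homo-− (+ rank (toℕ b) ℤ.- + rank (toℕ a)) (+ hit (toℕ b)))
                  (cong (_- carry b) (ι-homo-− (+ rank (toℕ b)) (+ rank (toℕ a))))

  pair-x : ∀ a b → pair x a b ≡ ι (k a b) + excess a b
  pair-x a b = begin
    pair x a b                                            ≡⟨ pair-toU (λ b → - height b) a b ⟩
    - (R a + frac a) - - (R b + frac b)                   ≡⟨ solve 5 (λ ra rb c fa fb → :- (ra :+ fa) :- :- (rb :+ fb)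
                                                               := rb :- ra :- c :+ (c :+ fb :- fa)) refl (R a) (R b) (carry b) (frac a) (frac b) ⟩
    R b - R a - carry b + excess a b                      ≡⟨ cong (_+ excess a b) (sym (ι-k a b)) ⟩
    ι (k a b) + excess a b                                ∎
    where open ≡-Reasoning

  pair-x₀ : ∀ a b → pair x₀ a b ≡ ι (k a b) + (excess a b - e * (t b - t a))
  pair-x₀ a b = begin
    pair x₀ a b                                                          ≡⟨ pair-toU (λ b → - (height b - e * t b)) a b ⟩
    - (R a + frac a - e * t a) - - (R b + frac b - e * t b)              ≡⟨ solve 8 (λ ra rb c fa fb e ta tb →
        :- (ra :+ fa :- e :* ta) :- :- (rb :+ fb :- e :* tb) := rb :- ra :- c :+ (c :+ fb :- fa :- e :* (tb :- ta)))
        refl (R a) (R b) (carry b) (frac a) (frac b) e (t a) (t b) ⟩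
    R b - R a - carry b + (excess a b - e * (t b - t a))                 ≡⟨ cong (_+ (excess a b - e * (t b - t a)))
                                                                                 (sym (ι-k a b)) ⟩
    ι (k a b) + (excess a b - e * (t b - t a))                           ∎
    where open ≡-Reasoning

  0<excess : ∀ {a b} → a <ᶠ b → 0ℚ < excess a b
  0<excess a<b = <-≤-trans (p<q⇒0<q-p (t-mono a<b)) (proj₁ (excess-bounds a<b))

  x₀∈A : InAlcove k x₀
  x₀∈A = toU-InU (λ b → - (height b - e * t b)) , λ a b a<b →
    fromStrictlyWithin (k a b) (subst (StrictlyWithin (ι (k a b))) (sym (pair-x₀ a b))
      (strictlyWithin-shift (perturbed-strictlyWithin 0<e e<1 (p<q⇒0<q-p (t-mono a<b))
        (proj₁ (excess-bounds a<b)) (proj₂ (excess-bounds a<b)))))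

  x∈C : InClosure k x
  x∈C = toU-InU (λ b → - height b) , λ a b a<b →
    fromWithin (k a b) (subst (Within (ι (k a b))) (sym (pair-x a b))
      (within-shift (<⇒≤ (0<excess a<b) , proj₂ (excess-bounds a<b))))

  x-integral⇒onPath : ∀ {a b} → a <ᶠ b → Integral (pair x a b) → OnPath a × OnPath b
  x-integral⇒onPath {a} {b} a<b ab∈ℤ = on (onPath? a ×-dec onPath? b)
    where
    on : Dec (OnPath a × OnPath b) → OnPath a × OnPath b
    on (yes both) = both
    on (no not-both) = ⊥-elim (strictlyWithin⇒nonIntegral (k a b)
      (subst (StrictlyWithin (ι (k a b))) (sym (pair-x a b)) (strictlyWithin-shift (0<excess a<b , excess-off-path not-both)))
      ab∈ℤ)

  x-on-path : ∀ {a b} → OnPath a → OnPath b → pair x a b ≡ ι (k a b) + 1ℚ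
  x-on-path {a} {b} a∈p b∈p = trans (pair-x a b) (cong (_+_ (ι (k a b))) (excess-on-path a∈p b∈p))

  0<path-level : ∀ {a b} → a <ᶠ b → OnPath b → 0ℚ < ι (k a b) + 1ℚ
  0<path-level {a} {b} a<b b∈p = <-byDiff level≡ (p<q⇒0<q-p (ι-mono-< (ℤ.+<+ (rank-step a<b (hit-on b∈p)))))
    where
    level≡ : ι (k a b) + 1ℚ - 0ℚ ≡ R b - R a
    level≡ = begin
      ι (k a b) + 1ℚ - 0ℚ       ≡⟨ cong (λ u → u + 1ℚ - 0ℚ) (ι-k a b) ⟩
      R b - R a - carry b + 1ℚ - 0ℚ ≡⟨ cong (λ c → R b - R a - c + 1ℚ - 0ℚ) (cong (λ h → ι (+ h)) (hit-on b∈p)) ⟩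
      R b - R a - 1ℚ + 1ℚ - 0ℚ  ≡⟨ solve 2 (λ u v → v :- u :- con 1ℚ :+ con 1ℚ :- con 0ℚ := v :- u) refl (R a) (R b) ⟩
      R b - R a                 ∎
      where open ≡-Reasoning

  consecutive-level : ∀ {a b} → toℕ b ≡ suc (toℕ a) → ι (k a b) ≡ 0ℚ
  consecutive-level {a} {b} b≡1+a = begin
    ι (k a b)                          ≡⟨ ι-k a b ⟩
    R b - R a - carry b                ≡⟨ cong (λ m → ι (+ rank m) - R a - ι (+ hit m)) b≡1+a ⟩
    ι (+ (ra ℕ.+ h)) - R a - ι (+ h)   ≡⟨ cong (λ u → u - R a - ι (+ h)) (ι-homo-+ (+ ra) (+ h)) ⟩
    R a + ι (+ h) - R a - ι (+ h)      ≡⟨ solve 2 (λ r h → r :+ h :- r :- h := con 0ℚ) refl (R a) (ι (+ h)) ⟩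
    0ℚ                                 ∎
    where
    open ≡-Reasoning
    ra h : ℕ
    ra = rank (toℕ a)
    h = hit (suc (toℕ a))

  first last : Fin (suc N)
  first = p zero
  last = p (fromℕ r)

  x∈H : InH x first last (k first last ℤ.+ + 1)
  x∈H = toU-InU (λ b → - height b) , trans (x-on-path (zero , refl) (fromℕ r , refl)) (sym (ι-suc (k first last)))

  x∈A♦ : InUpper k x
  x∈A♦ = x∈C , wall-through-x-is-ceiling
    where
    wall-through-x-is-ceiling : ∀ a b M → Wall k a b M → pair x a b ≡ ι M → Ceiling k a b M
    wall-through-x-is-ceiling a b M wall x-ab =
      upperWall⇒ceiling {k = k} wall M≡k+1 (subst (0ℚ <_) (sym M≡k+1) (0<path-level (proj₁ wall) (proj₂ on-path)))
      where
      on-path : OnPath a × OnPath b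
      on-path = x-integral⇒onPath (proj₁ wall) (M , x-ab)
      M≡k+1 : ι M ≡ ι (k a b) + 1ℚ
      M≡k+1 = trans (sym x-ab) (x-on-path (proj₁ on-path) (proj₂ on-path))

  alcove⊆P◇ : ∀ z → InAlcove k z → InP◇ z
  alcove⊆P◇ z (z∈U , bounds) = z∈U , consecutive-bounds
    where
    consecutive-bounds : ∀ a b → toℕ b ≡ suc (toℕ a) → 0ℚ < pair z a b × pair z a b ≤ ι (+ 1)
    consecutive-bounds a b b≡1+a =
      subst (_< pair z a b) k≡0 (proj₁ cell) ,
      <⇒≤ (subst (pair z a b <_) (trans (cong (_+ 1ℚ) k≡0) (+-identityˡ 1ℚ)) (proj₂ cell))
      where
      cell : StrictlyWithin (ι (k a b)) (pair z a b)
      cell = toStrictlyWithin (k a b) (bounds a b (subst (toℕ a ℕ.<_) (sym b≡1+a) (ℕₚ.n<1+n (toℕ a))))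
      k≡0 : ι (k a b) ≡ 0ℚ
      k≡0 = consecutive-level b≡1+a

  wall-through-x-joins-consecutive : ∀ {i' j' m'} → Wall k i' j' m' → pair x i' j' ≡ ι m' →
                                     ∀ {s s'} → p s ≡ i' → p s' ≡ j' → Consecutive s s'
  wall-through-x-joins-consecutive {i'} {j'} {m'} wall x-i'j' {s} {s'} ps≡i' ps'≡j' = joins (adjacent-or-between s<s')
    where
    s<s' : s <ᶠ s'
    s<s' = strictMono-reflects p p-mono (subst₂ _<ᶠ_ (sym ps≡i') (sym ps'≡j') (proj₁ wall))
    joins : Consecutive s s' ⊎ (Σ[ t ∈ Fin (suc r) ] (s <ᶠ t × t <ᶠ s')) → Consecutive s s'
    joins (inj₁ adjacent) = adjacent
    joins (inj₂ (t , s<t , t<s')) = ⊥-elim (wall-level-not-composite {k = k} wall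
      (subst (_<ᶠ p t) ps≡i' (p-mono s<t)) (subst (p t <ᶠ_) ps'≡j' (p-mono t<s')) (begin
        ι m'                                              ≡⟨ sym x-i'j' ⟩
        pair x i' j'                                      ≡⟨ pair-split x i' (p t) j' ⟩
        pair x i' (p t) + pair x (p t) j'                 ≡⟨ cong₂ _+_ (x-on-path (s , ps≡i') (t , refl))
                                                                           (x-on-path (t , refl) (s' , ps'≡j')) ⟩
        (ι (k i' (p t)) + 1ℚ) + (ι (k (p t) j') + 1ℚ)     ∎))
      where open ≡-Reasoning

  edgeless-path-refutes : (G : SimpleGraph (suc N)) → WorpitzkyCompatible (Ψ G) →
                          first <ᶠ last → Edge G first last →
                          (∀ s → ¬ Edge G (p (inject₁ s)) (p (suc s))) → ⊥
  edgeless-path-refutes G W i<j ij∈E no-edge =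
    refute (W k (x₀ , x₀∈A) alcove⊆P◇ first last i<j ij∈E (k first last ℤ.+ + 1) (x , x∈A♦ , x∈H))
    where
    refute : Σ[ i' ∈ Fin (suc N) ] Σ[ j' ∈ Fin (suc N) ] Σ[ m' ∈ ℤ ]
               (Ψ G i' j' × Ceiling k i' j' m' ×
                (∀ z → InUpper k z → InH z first last (k first last ℤ.+ + 1) → InH z i' j' m')) → ⊥
    refute (i' , j' , m' , i'j'∈E , ceiling , contained) =
      no-edge a (subst₂ (Edge G) (trans (sym ps≡i') (cong p (sym a≡s))) (trans (sym ps'≡j') (cong p (sym a+1≡s'))) i'j'∈E)
      where
      x-i'j' : pair x i' j' ≡ ι m'
      x-i'j' = proj₂ (contained x x∈A♦ x∈H)
      on-path : OnPath i' × OnPath j'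
      on-path = x-integral⇒onPath (proj₁ (proj₁ ceiling)) (m' , x-i'j')
      s s' : Fin (suc r)
      s = proj₁ (proj₁ on-path)
      s' = proj₁ (proj₂ on-path)
      ps≡i' : p s ≡ i'
      ps≡i' = proj₂ (proj₁ on-path)
      ps'≡j' : p s' ≡ j'
      ps'≡j' = proj₂ (proj₂ on-path)
      consecutive : Consecutive s s'
      consecutive = wall-through-x-joins-consecutive (proj₁ ceiling) x-i'j' ps≡i' ps'≡j'
      a : Fin r
      a = proj₁ consecutive
      a≡s : inject₁ a ≡ s
      a≡s = proj₁ (proj₂ consecutive)
      a+1≡s' : suc a ≡ s'
      a+1≡s' = proj₂ (proj₂ consecutive)

compatible⇒chordCondition : ∀ ℓ (G : SimpleGraph ℓ) → WorpitzkyCompatible (Ψ G) → ChordCondition G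
compatible⇒chordCondition zero G W ()
compatible⇒chordCondition (suc N) G W i j i<j ij∈E r p p-inc p0≡i pr≡j =
  decide (Finₚ.any? (λ s → SimpleGraph.adj G (p (inject₁ s)) (p (suc s)) Bool.≟ true))
  where
  decide : Dec (∃[ s ] Edge G (p (inject₁ s)) (p (suc s))) → ∃[ s ] Edge G (p (inject₁ s)) (p (suc s))
  decide (yes chord) = chord
  decide (no no-chord) = ⊥-elim (ObstructingAlcove.edgeless-path-refutes p p-inc G W
    (subst₂ _<ᶠ_ (sym p0≡i) (sym pr≡j) i<j) (subst₂ (Edge G) (sym p0≡i) (sym pr≡j) ij∈E) (λ s e → no-chord (s , e)))

chordCondition⇒compatible : ∀ ℓ (G : SimpleGraph ℓ) → ChordCondition G → WorpitzkyCompatible (Ψ G)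
chordCondition⇒compatible zero G chord k A≢∅ A⊆P◇ ()
chordCondition⇒compatible (suc n) G chord k (x₀ , x₀∈A) A⊆P◇ i j i<j ij∈E m (x , x∈A♦ , x∈H) =
  CeilingChains.chord⇒ceiling {k = k} {x₀} {x} x₀∈A (A⊆P◇ x₀ x₀∈A) x∈A♦ G chord {m = m} i<j ij∈E x∈H

corollary2p7 : (ℓ : ℕ) (G : SimpleGraph ℓ) →
    (WorpitzkyCompatible (Ψ G) → ChordCondition G) ×
    (ChordCondition G → WorpitzkyCompatible (Ψ G))
corollary2p7 ℓ G = compatible⇒chordCondition ℓ G , chordCondition⇒compatible ℓ G
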